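{- Let $\mathscr M=(Q,\Sigma,\Delta,\delta,\lambda,\mathsf i)$ be a Moore machine with $Q=\{\mathsf i\cdot w:w\in\Sigma^*\}$, let $\mathscr M_\star$ be its right dual with state set $Q_\star$, and let $\mathscr M^\natural$ be its bidual with state set $Q^\natural=\{\lambda_\star\cdot w: w\in\Sigma^*\}\subset\Delta^{Q_\star}$. Define $\tau:Q\to\Delta^{Q_\star}$ by $\tau_a(f)=f(a)$ for $a\in Q$, $f\in Q_\star$. Then $\lambda_\star\cdot w=\tau_{\mathsf i\cdot w}$ for all $w\in\Sigma^*$, so $\tau$ maps $Q$ onto $Q^\natural$ and $\operatorname{card}Q^\natural\le\operatorname{card}Q$. Moreover, for $a,b\in Q$, $\tau_a=\tau_b$ if and only if $\lambda(a\cdot w)=\lambda(b\cdot w)$ for all $w\in\Sigma^*$.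
   Context: A Moore machine is a 6-tuple $\mathscr M=(Q,\Sigma,\Delta,\delta,\lambda,\mathsf i)$ with $Q,\Sigma,\Delta$ finite sets, $\delta:Q\times\Sigma\to Q$, $\lambda:Q\to\Delta$, $\mathsf i\in Q$. Right action of words: $a\cdot\epsilon=a$, $a\cdot wj=\delta(a\cdot w,j)$; left action: $\epsilon\cdot a=a$, $jw\cdot a=\delta(w\cdot a,j)$. For $f:Q\to\Delta$: $(w\cdot f)(a)=f(a\cdot w)$, $(f\cdot w)(a)=f(w\cdot a)$. Right dual: $\mathscr M_\star=(Q_\star,\Sigma,\Delta,\delta_\star,\lambda_\star,\lambda)$ with $Q_\star=\{w\cdot\lambda:w\in\Sigma^*\}\subset\Delta^Q$, $\delta_\star(f,j)=j\cdot f$, $\lambda_\star(f)=f(\mathsf i)$, initial state $\lambda$. The left dual of a machine $(Q,\Sigma,\Delta,\delta,\lambda,\mathsf i)$ is $(\{\lambda\cdot w:w\in\Sigma^*\},\Sigma,\Delta,(f,j)\mapsto f\cdot j, f\mapsto f(\mathsf i),\lambda)$. The bidual $\mathscr M^\natural$ is the left dual of $\mathscr M_\star$; in it, for $F:Q_\star\to\Delta$ and $w\in\Sigma^*$, $(F\cdot w)(g)=F(w\cdot g)$ where $w\cdot g$ is the left action in $\mathscr M_\star$, and its initial state is $\lambda_\star$. -}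

module Defs where

open import Data.Nat using (ℕ)
open import Data.Fin using (Fin)
open import Data.List using (List; []; _∷_; foldl; foldr)
open import Data.Product using (Σ; ∃; ∃-syntax; _,_; proj₁)
open import Relation.Binary.PropositionalEquality using (_≡_; refl; trans; sym; cong)
open import Relation.Binary.Bundles using (Setoid)
open import Relation.Binary.Structures using (IsEquivalence)
open import Function.Bundles using (Surjection)
import Relation.Binary.PropositionalEquality as ≡

Word : Set → Set
Word Σ = List Σ

rightAct : {Q Σ : Set} → (Q → Σ → Q) → Q → Word Σ → Q
rightAct δ a w = foldl δ a w

leftAct : {Q Σ : Set} → (Q → Σ → Q) → Word Σ → Q → Q
leftAct δ w a = foldr (λ j b → δ b j) a w

record Moore (n s d : ℕ) : Set where
  field
    δ : Fin n → Fin s → Fin n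
    out : Fin n → Fin d          -- λ
    init : Fin n

module Duals {n s d : ℕ} (M : Moore n s d) where
  open Moore M

  Q = Fin n
  Sig = Fin s
  Δ = Fin d

  _·_ : Q → Word Sig → Q
  a · w = rightAct δ a w

  _·ˡ_ : Word Sig → Q → Q
  w ·ˡ a = leftAct δ w a

  _▹_ : Word Sig → (Q → Δ) → (Q → Δ)
  (w ▹ f) a = f (a · w)

  _≗_ : (Q → Δ) → (Q → Δ) → Set
  f ≗ g = ∀ a → f a ≡ g a

  Q⋆ : Set
  Q⋆ = Σ (Q → Δ) (λ f → ∃[ w ] f ≗ (w ▹ out))

  δ⋆ : Q⋆ → Sig → Q⋆
  δ⋆ (f , w , p) j = ((j ∷ []) ▹ f) , (j ∷ w) , (λ a → p (δ a j))

  λ⋆ : Q⋆ → Δ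
  λ⋆ (f , _) = f init

  i⋆ : Q⋆
  i⋆ = out , [] , (λ a → refl)

  _·⋆_ : Word Sig → Q⋆ → Q⋆
  w ·⋆ g = leftAct δ⋆ w g

  _≈♮_ : (Q⋆ → Δ) → (Q⋆ → Δ) → Set
  F ≈♮ G = ∀ g → F g ≡ G g

  _◃_ : (Q⋆ → Δ) → Word Sig → (Q⋆ → Δ)
  (F ◃ w) g = F (w ·⋆ g)

  Q♮ : Set
  Q♮ = Σ (Q⋆ → Δ) (λ F → ∃[ w ] F ≈♮ (λ⋆ ◃ w))

  Q♮-setoid : Setoid _ _
  Q♮-setoid = record
    { Carrier = Q♮
    ; _≈_ = λ F G → proj₁ F ≈♮ proj₁ G
    ; isEquivalence = record
      { refl = λ g → refl
      ; sym = λ p g → sym (p g)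
      ; trans = λ p q g → trans (p g) (q g) } }

  τ : Q → (Q⋆ → Δ)
  τ a (f , _) = f a

-- card A ≤ m for a setoid A (constructive reading): Fin m maps onto A
CardLe : ∀ {c ℓ} → Setoid c ℓ → ℕ → Set _
CardLe A m = Surjection (≡.setoid (Fin m)) A

-- The state of the right dual reached by a word v is the function a ↦ λ(a·v), so reading w in
-- the left action of M⋆ just precomposes with a ↦ a·w. Evaluating at λ⋆ = (f ↦ f(i)) gives
-- λ⋆·w = (f ↦ f(i·w)) = τ_{i·w}; as every state is i·w for some w, τ is onto Q♮. Two states
-- a, b have τ_a = τ_b exactly when every w·λ agrees on them, i.e. when λ(a·w) = λ(b·w) for all w.
module Submission where

open import Defs
open import Data.Nat using (ℕ)
open import Data.Fin using (Fin)
open import Data.List using ([]; _∷_)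
open import Data.Product using (∃-syntax; _×_; _,_; proj₁)
open import Relation.Binary.PropositionalEquality using (_≡_; refl; sym; trans)
open import Function.Bundles using (_⇔_; mk⇔)

module Bidual {n s d : ℕ} (M : Moore n s d) where
  open Moore M
  open Duals M

  proj₁-·⋆ : ∀ w (g : Q⋆) a → proj₁ (w ·⋆ g) a ≡ proj₁ g (a · w)
  proj₁-·⋆ []      g a = refl
  proj₁-·⋆ (j ∷ w) g a = proj₁-·⋆ w g (δ a j)

  λ⋆◃≈τ-init· : ∀ w → (λ⋆ ◃ w) ≈♮ τ (init · w)
  λ⋆◃≈τ-init· w g = proj₁-·⋆ w g init

  τ-cong : ∀ {a b} → a ≡ b → τ a ≈♮ τ b
  τ-cong refl g = refl

  τ-init·≈λ⋆◃ : ∀ w → ∃[ a ] τ a ≈♮ (λ⋆ ◃ w)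
  τ-init·≈λ⋆◃ w = init · w , λ g → sym (λ⋆◃≈τ-init· w g)

  τ≈♮τ⇔same-outputs : ∀ a b → (τ a ≈♮ τ b) ⇔ (∀ w → out (a · w) ≡ out (b · w))
  τ≈♮τ⇔same-outputs a b = mk⇔
    (λ τa≈τb w → τa≈τb ((w ▹ out) , w , λ _ → refl))
    (λ { same (f , v , f≗v▹out) → trans (f≗v▹out a) (trans (same v) (sym (f≗v▹out b))) })

  module Accessible (reach : ∀ a → ∃[ w ] init · w ≡ a) where

    τ∈Q♮ : ∀ a → ∃[ w ] τ a ≈♮ (λ⋆ ◃ w)
    τ∈Q♮ a with reach a
    ... | w , init·w≡a = w , λ g → trans (τ-cong (sym init·w≡a) g) (sym (λ⋆◃≈τ-init· w g))

    τ-surjection : CardLe Q♮-setoid n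
    τ-surjection = record
      { to         = λ a → τ a , τ∈Q♮ a
      ; cong       = τ-cong
      ; surjective = λ { (F , w , F≈λ⋆◃w) →
          init · w , λ { refl g → trans (sym (λ⋆◃≈τ-init· w g)) (sym (F≈λ⋆◃w g)) } }
      }

mainTheorem2 : {n s d : ℕ} (M : Moore n s d) →
    let open Moore M in
    let open Duals M in
    (∀ (a : Fin n) → ∃[ w ] init · w ≡ a) →
    (∀ (w : Word (Fin s)) → (λ⋆ ◃ w) ≈♮ τ (init · w))
    × (∀ (a : Fin n) → ∃[ w ] τ a ≈♮ (λ⋆ ◃ w))
    × (∀ (w : Word (Fin s)) → ∃[ a ] τ a ≈♮ (λ⋆ ◃ w))
    × CardLe Q♮-setoid n
    × (∀ (a b : Fin n) → (τ a ≈♮ τ b) ⇔ (∀ (w : Word (Fin s)) → out (a · w) ≡ out (b · w)))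
mainTheorem2 M reach =
  λ⋆◃≈τ-init· , τ∈Q♮ , τ-init·≈λ⋆◃ , τ-surjection , τ≈♮τ⇔same-outputs
  where
  open Bidual M
  open Accessible reach
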